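{- Let $\mathcal S$ be a non-simple step set and assume that the group $G(\mathcal S)$ is finite. Then $$\sum_{g\in G(\mathcal S)}\mathrm{sign}(g)\,g\big(xyQ(x,y;t)\big)=\frac{1}{K(x,y;t)}\sum_{g\in G(\mathcal S)}\mathrm{sign}(g)\,g(xy).$$
   Context: A step set $\mathcal S\subseteq\{ -1,0,1\}^2\setminus\{(0,0)\}$ is non-simple if (i) it contains a step with positive first coordinate, one with negative first coordinate, one with positive second coordinate and one with negative second coordinate; (ii) it contains at least one of $(1,0),(0,1),(1,1)$; (iii) it is not contained in $\{(-1,0),(0,1),(1,1),(-1,1),(-1,-1)\}$ nor in $\{(1,0),(0,-1),(1,1),(1,-1),(-1,-1)\}$. Let $q(i,j;n)$ be the number of length-$n$ walks from $(0,0)$ with steps in $\mathcal S$ staying in the quadrant $\{i\ge0,j\ge0\}$ and ending at $(i,j)$, and $Q(x,y;t)=\sum q(i,j;n)x^iy^jt^n$. Let $S(x,y)=\sum_{(i,j)\in\mathcal S}x^iy^j$, $K(x,y;t)=1-tS(x,y)$, $\bar x=1/x$, $\bar y=1/y$, and write $S(x,y)=A_{ -1}(x)\bar y+A_0(x)+A_1(x)y=B_{ -1}(y)\bar x+B_0(y)+B_1(y)x$. Let $\Phi(x,y)=(\bar x B_{ -1}(y)/B_1(y),y)$, $\Psi(x,y)=(x,\bar y A_{ -1}(x)/A_1(x))$, and $G(\mathcal S)$ the group they generate (a dihedral group). The sign of $g\in G(\mathcal S)$ is $1$ (resp. $-1$) if $g$ is a product of an even (resp. odd) number of generators $\Phi,\Psi$.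 For $g\in G(\mathcal S)$ and a function $A(x,y)$, $g(A(x,y)):=A(g(x,y))$; in particular $g(xyQ(x,y;t))$ is obtained by substituting the two rational coordinates of $g(x,y)$ for $x,y$ in each (polynomial) coefficient of $t^n$ of $xyQ(x,y;t)$. -}

module Defs where

open import Data.Bool using (Bool; true; false; if_then_else_)
open import Data.Nat as ℕ using (ℕ; zero; suc; _<_)
open import Data.Integer as ℤ using (ℤ; +_; -[1+_]; _≤ᵇ_)
open import Data.Rational as ℚ using (ℚ; 0ℚ; 1ℚ; _+_; _*_; _-_; 1/_; ≢-nonZero)
open import Data.Rational.Properties using (_≟_)
open import Data.List using (List; []; _∷_; map; concatMap; length; filterᵇ)
open import Data.Maybe using (Maybe; just; nothing; _>>=_)
open import Data.Product using (_×_; _,_; proj₁; proj₂; Σ; ∃)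
open import Data.Sum using (_⊎_)
open import Relation.Nullary using (¬_; yes; no)
open import Relation.Binary.PropositionalEquality using (_≡_; _≢_)
open import Data.Fin using (Fin)

data V : Set where
  m1 z p1 : V

val : V → ℤ
val m1 = -[1+ 0 ]
val z  = + 0
val p1 = + 1

Step : Set
Step = V × V

-- A step set: a subset of {-1,0,1}^2, given by its characteristic
-- function (the hypothesis that (0,0) is excluded is stated separately).
StepSet : Set
StepSet = V → V → Bool

_∈S_ : Step → StepSet → Set
(a , b) ∈S S = S a b ≡ true

allSteps : List Step
allSteps = (m1 , m1) ∷ (m1 , z) ∷ (m1 , p1) ∷ (z , m1) ∷ (z , z) ∷ (z , p1)
         ∷ (p1 , m1) ∷ (p1 , z) ∷ (p1 , p1) ∷ []

steps : StepSet → List Step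
steps S = filterᵇ (λ s → S (proj₁ s) (proj₂ s)) allSteps

-- the two exceptional sets of condition (iii)
inE1 : Step → Set
inE1 (m1 , z)  = Data.Unit.⊤ where import Data.Unit
inE1 (z , p1)  = Data.Unit.⊤ where import Data.Unit
inE1 (p1 , p1) = Data.Unit.⊤ where import Data.Unit
inE1 (m1 , p1) = Data.Unit.⊤ where import Data.Unit
inE1 (m1 , m1) = Data.Unit.⊤ where import Data.Unit
inE1 _         = Data.Empty.⊥ where import Data.Empty

inE2 : Step → Set
inE2 (p1 , z)  = Data.Unit.⊤ where import Data.Unit
inE2 (z , m1)  = Data.Unit.⊤ where import Data.Unit
inE2 (p1 , p1) = Data.Unit.⊤ where import Data.Unit
inE2 (p1 , m1) = Data.Unit.⊤ where import Data.Unit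
inE2 (m1 , m1) = Data.Unit.⊤ where import Data.Unit
inE2 _         = Data.Empty.⊥ where import Data.Empty

record NonSimple (S : StepSet) : Set where
  field
    posX : ∃ λ b → (p1 , b) ∈S S
    negX : ∃ λ b → (m1 , b) ∈S S
    posY : ∃ λ a → (a , p1) ∈S S
    negY : ∃ λ a → (a , m1) ∈S S
    small : ((p1 , z) ∈S S) ⊎ (((z , p1) ∈S S) ⊎ ((p1 , p1) ∈S S))
    notSub1 : ¬ (∀ s → s ∈S S → inE1 s)
    notSub2 : ¬ (∀ s → s ∈S S → inE2 s)

words : StepSet → ℕ → List (List Step)
words S zero    = [] ∷ []
words S (suc n) = concatMap (λ w → map (λ s → s ∷ w) (steps S)) (words S n)

nonneg : ℤ → Bool
nonneg k = + 0 ≤ᵇ k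

eqℤ : ℤ → ℤ → Bool
eqℤ a b = (a ≤ᵇ b) Data.Bool.∧ (b ≤ᵇ a) where import Data.Bool

quadWalk : ℤ → ℤ → List Step → ℤ → ℤ → Bool
quadWalk a b [] i j = eqℤ a i Data.Bool.∧ eqℤ b j where import Data.Bool
quadWalk a b ((u , v) ∷ w) i j =
  let a' = a ℤ.+ val u ; b' = b ℤ.+ val v in
  (nonneg a' Data.Bool.∧ nonneg b') Data.Bool.∧ quadWalk a' b' w i j
  where import Data.Bool

q : StepSet → ℕ → ℕ → ℕ → ℕ
q S i j n = length (filterᵇ (λ w → quadWalk (+ 0) (+ 0) w (+ i) (+ j)) (words S n))

pow : ℚ → ℕ → ℚ
pow x zero    = 1ℚ
pow x (suc n) = x * pow x n

fromℕ : ℕ → ℚ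
fromℕ n = ℚ.mkℚ+ n 1 (Data.Nat.Coprimality.sym (Data.Nat.Coprimality.1-coprimeTo n))
  where import Data.Nat.Coprimality

sumTo : ℕ → (ℕ → ℚ) → ℚ
sumTo zero    f = 0ℚ
sumTo (suc n) f = sumTo n f + f n

divM : ℚ → ℚ → Maybe ℚ
divM a b with b ≟ 0ℚ
... | yes _  = nothing
... | no b≢0 = just (a * (1/ b) {{≢-nonZero b≢0}})

Pt : Set
Pt = ℚ × ℚ

c : StepSet → V → V → ℚ
c S a b = if S a b then 1ℚ else 0ℚ

-- the n-th coefficient (in t) of x y Q(x,y;t), evaluated at a point
xyQ : StepSet → ℕ → Pt → ℚ
xyQ S n (x , y) =
  x * y * sumTo (suc n) (λ i → sumTo (suc n) (λ j →
    fromℕ (q S i j n) * pow x i * pow y j))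

xy : Pt → ℚ
xy (x , y) = x * y

Sxy : StepSet → (x y : ℚ) → x ≢ 0ℚ → y ≢ 0ℚ → ℚ
Sxy S x y x≢0 y≢0 =
  sumV (λ a → sumV (λ b → c S a b * powZ x x' a * powZ y y' b))
  where
  x' = (1/ x) {{≢-nonZero x≢0}}
  y' = (1/ y) {{≢-nonZero y≢0}}
  powZ : ℚ → ℚ → V → ℚ
  powZ u u' m1 = u'
  powZ u u' z  = 1ℚ
  powZ u u' p1 = u
  sumV : (V → ℚ) → ℚ
  sumV f = f m1 + f z + f p1

-- Φ(x,y) = (x̄ B₋₁(y)/B₁(y), y) = ( y B₋₁(y) / (x · y B₁(y)) , y )
Φ : StepSet → Pt → Maybe Pt
Φ S (x , y) =
  divM (c S m1 m1 + c S m1 z * y + c S m1 p1 * y * y)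
       (x * (c S p1 m1 + c S p1 z * y + c S p1 p1 * y * y))
  >>= λ x' → just (x' , y)

-- Ψ(x,y) = (x, ȳ A₋₁(x)/A₁(x)) = ( x , x A₋₁(x) / (y · x A₁(x)) )
Ψ : StepSet → Pt → Maybe Pt
Ψ S (x , y) =
  divM (c S m1 m1 + c S z m1 * x + c S p1 m1 * x * x)
       (y * (c S m1 p1 + c S z p1 * x + c S p1 p1 * x * x))
  >>= λ y' → just (x , y')

rot : StepSet → ℕ → Pt → Maybe Pt
rot S zero    p = just p
rot S (suc k) p = rot S k p >>= λ p' → Ψ S p' >>= Φ S

-- a power (ΦΨ)^k is the identity (as a rational map): it fixes every
-- rational point at which it is defined
IsId : StepSet → ℕ → Set
IsId S k = ∀ (p p' : Pt) → rot S k p ≡ just p' → p' ≡ p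

-- m is the order of ΦΨ; then G(S) is the dihedral group of order 2m with
-- elements (ΦΨ)^k (sign +1) and (ΦΨ)^k Φ (sign -1), 0 ≤ k < m
IsOrderΦΨ : StepSet → ℕ → Set
IsOrderΦΨ S m = (0 < m) × IsId S m × (∀ k → 0 < k → k < m → ¬ IsId S k)

-- Σ_{g ∈ G(S)} sign(g) g(F) evaluated at p; nothing if some g(p) is undefined
groupSum : StepSet → ℕ → (Pt → ℚ) → Pt → Maybe ℚ
groupSum S zero    F p = just 0ℚ
groupSum S (suc k) F p =
  groupSum S k F p >>= λ acc →
  rot S k p >>= λ p₊ →
  (Φ S p >>= rot S k) >>= λ p₋ →
  just (acc + (F p₊ - F p₋))

-- The value s = S(x,y) is invariant under Φ and Ψ: each replaces one coordinate u by the other root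
-- u′ = α / (u γ) of the quadratic equation xy S(x,y) = s xy in that coordinate (Vieta). So at every point
-- of the orbit the kernel equation reads
--   xy Qₙ₊₁ = s · xy Qₙ − x A₋₁(x) Qₙ(x,0) − y B₋₁(y) Qₙ(0,y) + [(−1,−1) ∈ S] Qₙ(0,0)
-- with the same s. In the signed sum over the group the constant term cancels, and the terms depending
-- only on x (resp. y) cancel in pairs g, Ψ g (resp. g, Φ g) of opposite sign, which have equal x (resp.
-- y); induction on n then gives the identity. Because Φ and Ψ are partial maps on rational points, the
-- pairing is set up by walking along the orbit, which is possible as long as the relevant coordinate is
-- nonzero; a point with y = 0 lies on the x-axis, where invariance forces x A₋₁(x) = 0, so the x-terms
-- vanish there anyway. The pairing needs an orbit of length m ≥ 2, and indeed ΦΨ ≠ id for a non-simple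
-- step set: ΦΨ moves (1, y) to height x A₋₁(1) / (y · x A₁(1)), which cannot equal y for both y = 1, 2.
module Submission where

open import Defs
open import Data.Bool using (Bool; true; false; if_then_else_; _∧_)
open import Data.Nat as ℕ using (ℕ; zero; suc; _<_; _≤_; z<s; s<s; s≤s)
import Data.Nat.Properties as ℕ
import Data.Integer as ℤ
import Data.Integer.Properties as ℤ
open import Data.Rational as ℚ using (ℚ; 0ℚ; 1ℚ; _+_; _*_; _-_; 1/_; ≢-nonZero; Positive; NonNegative; positive)
open import Data.Rational.Properties
import Data.Rational.Unnormalised.Base as ℚᵘ
import Data.Rational.Unnormalised.Properties as ℚᵘ
open import Data.Rational.Solver
open +-*-Solver
open import Data.List using (List; []; _∷_; map; concatMap; length; filterᵇ; _++_)
open import Data.Maybe using (Maybe; just; nothing; _>>=_; maybe′; fromMaybe)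
open import Data.Product using (_×_; _,_; proj₁; proj₂; ∃; uncurry)
open import Data.Sum using (_⊎_; inj₁; inj₂)
open import Data.Empty using (⊥-elim)
open import Function using (_∘_)
open import Relation.Nullary using (yes; no; ¬_)
open import Relation.Binary.PropositionalEquality

*-cancelˡ : ∀ x {a b} → x ≢ 0ℚ → x * a ≡ x * b → a ≡ b
*-cancelˡ x {a} {b} x≢0 eq = begin
  a                  ≡⟨ *-identityˡ a ⟨
  1ℚ * a             ≡⟨ cong (_* a) (*-inverseˡ x) ⟨
  (1/ x) * x * a     ≡⟨ *-assoc (1/ x) x a ⟩
  (1/ x) * (x * a)   ≡⟨ cong ((1/ x) *_) eq ⟩
  (1/ x) * (x * b)   ≡⟨ *-assoc (1/ x) x b ⟨
  (1/ x) * x * b     ≡⟨ cong (_* b) (*-inverseˡ x) ⟩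
  1ℚ * b             ≡⟨ *-identityˡ b ⟩
  b                  ∎
  where open ≡-Reasoning
        instance _ = ≢-nonZero x≢0

*-≢0 : ∀ {x y} → x ≢ 0ℚ → y ≢ 0ℚ → x * y ≢ 0ℚ
*-≢0 {x} {y} x≢0 y≢0 xy≡0 = y≢0 (*-cancelˡ x x≢0 (trans xy≡0 (sym (*-zeroʳ x))))

*-≢0ˡ : ∀ {x} y → x * y ≢ 0ℚ → x ≢ 0ℚ
*-≢0ˡ y xy≢0 refl = xy≢0 (*-zeroˡ y)

*-≢0ʳ : ∀ x {y} → x * y ≢ 0ℚ → y ≢ 0ℚ
*-≢0ʳ x xy≢0 refl = xy≢0 (*-zeroʳ x)

divM≡just⇒ : ∀ {a b r} → divM a b ≡ just r → b ≢ 0ℚ × r * b ≡ a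
divM≡just⇒ {a} {b} eq with b ≟ 0ℚ
divM≡just⇒ {a} {b} refl | no b≢0 = b≢0 , (begin
  a * (1/ b) * b     ≡⟨ *-assoc a (1/ b) b ⟩
  a * ((1/ b) * b)   ≡⟨ cong (a *_) (*-inverseˡ b) ⟩
  a * 1ℚ             ≡⟨ *-identityʳ a ⟩
  a                  ∎)
  where open ≡-Reasoning
        instance _ = ≢-nonZero b≢0

divM≡just⇐ : ∀ {a b r} → b ≢ 0ℚ → r * b ≡ a → divM a b ≡ just r
divM≡just⇐ {a} {b} {r} b≢0 eq with b ≟ 0ℚ
... | yes b≡0 = ⊥-elim (b≢0 b≡0)
... | no b≢0′ = cong just (begin
  a * (1/ b)         ≡⟨ cong (_* (1/ b)) eq ⟨
  r * b * (1/ b)     ≡⟨ *-assoc r b (1/ b) ⟩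
  r * (b * (1/ b))   ≡⟨ cong (r *_) (*-inverseʳ b) ⟩
  r * 1ℚ             ≡⟨ *-identityʳ r ⟩
  r                  ∎)
  where open ≡-Reasoning
        instance _ = ≢-nonZero b≢0′

divM-defined : ∀ a {b} → b ≢ 0ℚ → ∃ λ r → divM a b ≡ just r
divM-defined a {b} b≢0 with b ≟ 0ℚ
... | yes b≡0 = ⊥-elim (b≢0 b≡0)
... | no _    = _ , refl

>>=-just : ∀ {A B : Set} (ma : Maybe A) {f : A → Maybe B} {b} →
           (ma >>= f) ≡ just b → ∃ λ a → ma ≡ just a × f a ≡ just b
>>=-just (just a) eq = a , refl , eq

>>=-assoc : ∀ {A B C : Set} (ma : Maybe A) (f : A → Maybe B) (g : B → Maybe C) →
            ((ma >>= f) >>= g) ≡ (ma >>= λ a → f a >>= g)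
>>=-assoc (just a) f g = refl
>>=-assoc nothing  f g = refl

>>=-identityʳ : ∀ {A : Set} (ma : Maybe A) → (ma >>= just) ≡ ma
>>=-identityʳ (just a) = refl
>>=-identityʳ nothing  = refl

>>=-cong : ∀ {A B : Set} (ma : Maybe A) {f g : A → Maybe B} → (∀ a → f a ≡ g a) → (ma >>= f) ≡ (ma >>= g)
>>=-cong (just a) f≗g = f≗g a
>>=-cong nothing  f≗g = refl

fromMaybe-just : ∀ {A : Set} {d : A} {ma a} → ma ≡ just a → ma ≡ just (fromMaybe d ma)
fromMaybe-just refl = refl

quadratic : (α β γ u : ℚ) → ℚ
quadratic α β γ u = α + β * u + γ * u * u

-- Φ acts on x by reflect (yB₋₁ S y) (yB₁ S y), and Ψ acts on y by reflect (xA₋₁ S x) (xA₁ S x).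
reflect : (α γ u : ℚ) → Maybe ℚ
reflect α γ u = divM α (u * γ)

module _ {α γ u u′ : ℚ} (r : reflect α γ u ≡ just u′) where

  reflect-≢0 : u ≢ 0ℚ
  reflect-≢0 = *-≢0ˡ γ (proj₁ (divM≡just⇒ r))

  reflect-product : u′ * (u * γ) ≡ α
  reflect-product = proj₂ (divM≡just⇒ r)

  reflect-involutive : u′ ≢ 0ℚ → reflect α γ u′ ≡ just u
  reflect-involutive u′≢0 = divM≡just⇐
    (*-≢0 u′≢0 (*-≢0ʳ u (proj₁ (divM≡just⇒ r))))
    (trans (solve 3 (λ u u′ γ → u :* (u′ :* γ) := u′ :* (u :* γ)) refl u u′ γ) reflect-product)

  -- Vieta: u and u′ are the two roots of γ X² + (β − σ) X + α.
  reflect-quadratic : ∀ β σ → quadratic α β γ u ≡ σ * u → quadratic α β γ u′ ≡ σ * u′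
  reflect-quadratic β σ onLevel = *-cancelˡ u reflect-≢0 (begin
    u * quadratic α β γ u′                  ≡⟨ cong (λ α → u * quadratic α β γ u′) reflect-product ⟨
    u * quadratic (u′ * (u * γ)) β γ u′     ≡⟨ vieta u u′ β γ ⟩
    u′ * quadratic (u′ * (u * γ)) β γ u     ≡⟨ cong (λ α → u′ * quadratic α β γ u) reflect-product ⟩
    u′ * quadratic α β γ u                  ≡⟨ cong (u′ *_) onLevel ⟩
    u′ * (σ * u)                            ≡⟨ solve 3 (λ u u′ σ → u′ :* (σ :* u) := u :* (σ :* u′)) refl u u′ σ ⟩
    u * (σ * u′)                            ∎)
    where
    open ≡-Reasoning
    vieta : ∀ u u′ β γ → u * quadratic (u′ * (u * γ)) β γ u′ ≡ u′ * quadratic (u′ * (u * γ)) β γ u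
    vieta = solve 4 (λ u u′ β γ →
      u :* (u′ :* (u :* γ) :+ β :* u′ :+ γ :* u′ :* u′) := u′ :* (u′ :* (u :* γ) :+ β :* u :+ γ :* u :* u)) refl

indicator : Bool → ℚ
indicator b = if b then 1ℚ else 0ℚ

rowPoly : (V → Bool) → ℚ → ℚ
rowPoly f = quadratic (indicator (f m1)) (indicator (f z)) (indicator (f p1))

-- yBₐ S y = y Bₐ(y) and xAₐ S x = x Aₐ(x) in the notation of the paper; xyS S x y = x y S(x,y).
yB₋₁ yB₀ yB₁ xA₋₁ xA₀ xA₁ : StepSet → ℚ → ℚ
yB₋₁ S = rowPoly (S m1)
yB₀  S = rowPoly (S z)
yB₁  S = rowPoly (S p1)
xA₋₁ S = rowPoly (λ a → S a m1)
xA₀  S = rowPoly (λ a → S a z)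
xA₁  S = rowPoly (λ a → S a p1)

xyS : StepSet → ℚ → ℚ → ℚ
xyS S x y = quadratic (yB₋₁ S y) (yB₀ S y) (yB₁ S y) x

xyS-by-columns : ∀ S x y → xyS S x y ≡ quadratic (xA₋₁ S x) (xA₀ S x) (xA₁ S x) y
xyS-by-columns S x y = solve 11 (λ x y c₁ c₂ c₃ c₄ c₅ c₆ c₇ c₈ c₉ →
    (c₁ :+ c₂ :* y :+ c₃ :* y :* y) :+ (c₄ :+ c₅ :* y :+ c₆ :* y :* y) :* x :+ (c₇ :+ c₈ :* y :+ c₉ :* y :* y) :* x :* x
    := (c₁ :+ c₄ :* x :+ c₇ :* x :* x) :+ (c₂ :+ c₅ :* x :+ c₈ :* x :* x) :* y :+ (c₃ :+ c₆ :* x :+ c₉ :* x :* x) :* y :* y)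
  refl x y (c S m1 m1) (c S m1 z) (c S m1 p1) (c S z m1) (c S z z) (c S z p1) (c S p1 m1) (c S p1 z) (c S p1 p1)

xyS-on-x-axis : ∀ S x → xyS S x 0ℚ ≡ xA₋₁ S x
xyS-on-x-axis S x = trans (xyS-by-columns S x 0ℚ)
  (solve 3 (λ a b d → a :+ b :* con 0ℚ :+ d :* con 0ℚ :* con 0ℚ := a) refl (xA₋₁ S x) (xA₀ S x) (xA₁ S x))

-- xyS S x y with the factors u = x̄ x and v = ȳ y that arise from Sxy S x y * (x * y) still in place
xySWith : StepSet → (x y u v : ℚ) → ℚ
xySWith S x y u v =
  c S m1 m1 * (u * v) + c S m1 z * (u * y) + c S m1 p1 * (u * (y * y))
  + c S z m1 * (x * v) + c S z z * (x * y) + c S z p1 * (x * (y * y))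
  + c S p1 m1 * ((x * x) * v) + c S p1 z * ((x * x) * y) + c S p1 p1 * ((x * x) * (y * y))

Sxy-times-xy : ∀ S x y (x≢0 : x ≢ 0ℚ) (y≢0 : y ≢ 0ℚ) → Sxy S x y x≢0 y≢0 * (x * y) ≡ xyS S x y
Sxy-times-xy S x y x≢0 y≢0 = begin
  Sxy S x y x≢0 y≢0 * (x * y)
    ≡⟨ solve 13 (λ x x̄ y ȳ c₁ c₂ c₃ c₄ c₅ c₆ c₇ c₈ c₉ →
         (c₁ :* x̄ :* ȳ :+ c₂ :* x̄ :* con 1ℚ :+ c₃ :* x̄ :* y
          :+ (c₄ :* con 1ℚ :* ȳ :+ c₅ :* con 1ℚ :* con 1ℚ :+ c₆ :* con 1ℚ :* y)
          :+ (c₇ :* x :* ȳ :+ c₈ :* x :* con 1ℚ :+ c₉ :* x :* y)) :* (x :* y)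
         := c₁ :* ((x̄ :* x) :* (ȳ :* y)) :+ c₂ :* ((x̄ :* x) :* y) :+ c₃ :* ((x̄ :* x) :* (y :* y))
            :+ c₄ :* (x :* (ȳ :* y)) :+ c₅ :* (x :* y) :+ c₆ :* (x :* (y :* y))
            :+ c₇ :* ((x :* x) :* (ȳ :* y)) :+ c₈ :* ((x :* x) :* y) :+ c₉ :* ((x :* x) :* (y :* y)))
         refl x (1/ x) y (1/ y) (c S m1 m1) (c S m1 z) (c S m1 p1) (c S z m1) (c S z z) (c S z p1)
         (c S p1 m1) (c S p1 z) (c S p1 p1) ⟩
  xySWith S x y ((1/ x) * x) ((1/ y) * y)
    ≡⟨ cong₂ (xySWith S x y) (*-inverseˡ x) (*-inverseˡ y) ⟩
  xySWith S x y 1ℚ 1ℚ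
    ≡⟨ solve 11 (λ x y c₁ c₂ c₃ c₄ c₅ c₆ c₇ c₈ c₉ →
         c₁ :* (con 1ℚ :* con 1ℚ) :+ c₂ :* (con 1ℚ :* y) :+ c₃ :* (con 1ℚ :* (y :* y))
         :+ c₄ :* (x :* con 1ℚ) :+ c₅ :* (x :* y) :+ c₆ :* (x :* (y :* y))
         :+ c₇ :* ((x :* x) :* con 1ℚ) :+ c₈ :* ((x :* x) :* y) :+ c₉ :* ((x :* x) :* (y :* y))
         := (c₁ :+ c₂ :* y :+ c₃ :* y :* y) :+ (c₄ :+ c₅ :* y :+ c₆ :* y :* y) :* x
            :+ (c₇ :+ c₈ :* y :+ c₉ :* y :* y) :* x :* x)
         refl x y (c S m1 m1) (c S m1 z) (c S m1 p1) (c S z m1) (c S z z) (c S z p1) (c S p1 m1) (c S p1 z) (c S p1 p1) ⟩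
  xyS S x y ∎
  where
  open ≡-Reasoning
  instance _ = ≢-nonZero x≢0
           _ = ≢-nonZero y≢0

OnLevel : StepSet → ℚ → Pt → Set
OnLevel S s q = xyS S (proj₁ q) (proj₂ q) ≡ s * xy q

OnLevel-x-axis : ∀ {S s q} → OnLevel S s q → proj₂ q ≡ 0ℚ → xA₋₁ S (proj₁ q) ≡ 0ℚ
OnLevel-x-axis {S} {s} {x , y} onLevel refl = begin
  xA₋₁ S x         ≡⟨ xyS-on-x-axis S x ⟨
  xyS S x 0ℚ       ≡⟨ onLevel ⟩
  s * (x * 0ℚ)     ≡⟨ cong (s *_) (*-zeroʳ x) ⟩
  s * 0ℚ           ≡⟨ *-zeroʳ s ⟩
  0ℚ               ∎
  where open ≡-Reasoning

module Generators (S : StepSet) where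

  Φ-just : ∀ p {q} → Φ S p ≡ just q →
           ∃ λ x′ → reflect (yB₋₁ S (proj₂ p)) (yB₁ S (proj₂ p)) (proj₁ p) ≡ just x′ × q ≡ (x′ , proj₂ p)
  Φ-just p eq with >>=-just (reflect (yB₋₁ S (proj₂ p)) (yB₁ S (proj₂ p)) (proj₁ p)) eq
  ... | x′ , r , refl = x′ , r , refl

  Ψ-just : ∀ p {q} → Ψ S p ≡ just q →
           ∃ λ y′ → reflect (xA₋₁ S (proj₁ p)) (xA₁ S (proj₁ p)) (proj₂ p) ≡ just y′ × q ≡ (proj₁ p , y′)
  Ψ-just p eq with >>=-just (reflect (xA₋₁ S (proj₁ p)) (xA₁ S (proj₁ p)) (proj₂ p)) eq
  ... | y′ , r , refl = y′ , r , refl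

  Φ-keeps-y : ∀ q {q′} → Φ S q ≡ just q′ → proj₂ q′ ≡ proj₂ q
  Φ-keeps-y q eq with Φ-just q eq
  ... | _ , _ , refl = refl

  Ψ-keeps-x : ∀ q {q′} → Ψ S q ≡ just q′ → proj₁ q′ ≡ proj₁ q
  Ψ-keeps-x q eq with Ψ-just q eq
  ... | _ , _ , refl = refl

  Φ-x≢0 : ∀ q {q′} → Φ S q ≡ just q′ → proj₁ q ≢ 0ℚ
  Φ-x≢0 q eq with Φ-just q eq
  ... | _ , r , _ = reflect-≢0 r

  Ψ-y≢0 : ∀ q {q′} → Ψ S q ≡ just q′ → proj₂ q ≢ 0ℚ
  Ψ-y≢0 q eq with Ψ-just q eq
  ... | _ , r , _ = reflect-≢0 r

  Φ-involutive : ∀ q {q′} → Φ S q ≡ just q′ → proj₁ q′ ≢ 0ℚ → Φ S q′ ≡ just q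
  Φ-involutive q eq x′≢0 with Φ-just q eq
  ... | _ , r , refl = cong (_>>= _) (reflect-involutive r x′≢0)

  Ψ-involutive : ∀ q {q′} → Ψ S q ≡ just q′ → proj₂ q′ ≢ 0ℚ → Ψ S q′ ≡ just q
  Ψ-involutive q eq y′≢0 with Ψ-just q eq
  ... | _ , r , refl = cong (_>>= _) (reflect-involutive r y′≢0)

  Φ-OnLevel : ∀ q {q′} {s} → Φ S q ≡ just q′ → OnLevel S s q → OnLevel S s q′
  Φ-OnLevel q {s = s} eq onLevel with Φ-just q eq
  ... | x′ , r , refl =
    trans (reflect-quadratic r (yB₀ S y) (s * y) (trans onLevel (rearrange (proj₁ q)))) (sym (rearrange x′))
    where
    y = proj₂ q
    rearrange : ∀ u → s * (u * y) ≡ s * y * u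
    rearrange u = solve 3 (λ s u y → s :* (u :* y) := s :* y :* u) refl s u y

  Ψ-OnLevel : ∀ q {q′} {s} → Ψ S q ≡ just q′ → OnLevel S s q → OnLevel S s q′
  Ψ-OnLevel q {s = s} eq onLevel with Ψ-just q eq
  ... | y′ , r , refl = begin
    xyS S x y′                                       ≡⟨ xyS-by-columns S x y′ ⟩
    quadratic (xA₋₁ S x) (xA₀ S x) (xA₁ S x) y′      ≡⟨ reflect-quadratic r (xA₀ S x) (s * x) (begin
      quadratic (xA₋₁ S x) (xA₀ S x) (xA₁ S x) y       ≡⟨ xyS-by-columns S x y ⟨
      xyS S x y                                        ≡⟨ onLevel ⟩
      s * (x * y)                                      ≡⟨ *-assoc s x y ⟨
      s * x * y                                        ∎) ⟩
    s * x * y′                                       ≡⟨ *-assoc s x y′ ⟩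
    s * (x * y′)                                     ∎
    where
    open ≡-Reasoning
    x = proj₁ q
    y = proj₂ q

indicator-nonNeg : ∀ b → NonNegative (indicator b)
indicator-nonNeg false = _
indicator-nonNeg true  = _

indicator-pos : ∀ {b} → b ≡ true → Positive (indicator b)
indicator-pos refl = _

quadratic-pos : ∀ {α β γ} u → .{{NonNegative α}} → .{{NonNegative β}} → .{{NonNegative γ}} → .{{Positive u}} →
                Positive α ⊎ Positive β ⊎ Positive γ → Positive (quadratic α β γ u)
quadratic-pos {α} {β} {γ} u (inj₁ α>0) =
  pos+nonNeg⇒pos (α + β * u) {{pos+nonNeg⇒pos α {{α>0}} (β * u) {{βu≥0}}}} (γ * u * u) {{γuu≥0}}
  where βu≥0 = nonNeg*nonNeg⇒nonNeg β u {{pos⇒nonNeg u}}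
        γuu≥0 = nonNeg*nonNeg⇒nonNeg (γ * u) {{nonNeg*nonNeg⇒nonNeg γ u {{pos⇒nonNeg u}}}} u {{pos⇒nonNeg u}}
quadratic-pos {α} {β} {γ} u (inj₂ (inj₁ β>0)) =
  pos+nonNeg⇒pos (α + β * u) {{nonNeg+pos⇒pos α (β * u) {{pos*pos⇒pos β {{β>0}} u}}}} (γ * u * u) {{γuu≥0}}
  where γuu≥0 = nonNeg*nonNeg⇒nonNeg (γ * u) {{nonNeg*nonNeg⇒nonNeg γ u {{pos⇒nonNeg u}}}} u {{pos⇒nonNeg u}}
quadratic-pos {α} {β} {γ} u (inj₂ (inj₂ γ>0)) =
  nonNeg+pos⇒pos (α + β * u) {{α+βu≥0}} (γ * u * u) {{pos*pos⇒pos (γ * u) {{pos*pos⇒pos γ {{γ>0}} u}} u}}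
  where α+βu≥0 = nonNeg+nonNeg⇒nonNeg α (β * u) {{nonNeg*nonNeg⇒nonNeg β u {{pos⇒nonNeg u}}}}

rowPoly-pos : ∀ (f : V → Bool) → (∃ λ v → f v ≡ true) → ∀ u → .{{Positive u}} → Positive (rowPoly f u)
rowPoly-pos f (v , fv) u =
  quadratic-pos {indicator (f m1)} {indicator (f z)} {indicator (f p1)} u
    {{indicator-nonNeg (f m1)}} {{indicator-nonNeg (f z)}} {{indicator-nonNeg (f p1)}} (witness v fv)
  where
  witness : ∀ v → f v ≡ true →
            Positive (indicator (f m1)) ⊎ Positive (indicator (f z)) ⊎ Positive (indicator (f p1))
  witness m1 fv = inj₁ (indicator-pos fv)
  witness z  fv = inj₂ (inj₁ (indicator-pos fv))
  witness p1 fv = inj₂ (inj₂ (indicator-pos fv))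

pos-quotient : ∀ {r b a} → r * b ≡ a → Positive a → Positive b → Positive r
pos-quotient {r} {b} {a} rb≡a a>0 b>0 = positive (*-cancelʳ-<-nonNeg b {{pos⇒nonNeg b {{b>0}}}} {0ℚ} {r}
  (subst₂ ℚ._<_ (sym (*-zeroˡ b)) (sym rb≡a) (positive⁻¹ a {{a>0}})))

pos⇒≢0 : ∀ p → .{{Positive p}} → p ≢ 0ℚ
pos⇒≢0 p = ≢-sym (<⇒≢ (positive⁻¹ p))

module _ {S : StepSet} (nonSimple : NonSimple S) where

  private
    a₋ a₊ : ℚ
    a₋ = xA₋₁ S 1ℚ
    a₊ = xA₁ S 1ℚ

    a₋>0 : Positive a₋
    a₋>0 = rowPoly-pos (λ a → S a m1) (NonSimple.negY nonSimple) 1ℚ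

    a₊>0 : Positive a₊
    a₊>0 = rowPoly-pos (λ a → S a p1) (NonSimple.posY nonSimple) 1ℚ

    -- ΦΨ (1 , y) is defined for y > 0 and has second coordinate y′ = a₋ / (y a₊).
    fixed-height : IsId S 1 → ∀ y → .{{Positive y}} → y * (y * a₊) ≡ a₋
    fixed-height isId y = subst (λ v → v * (y * a₊) ≡ a₋) y′≡y y′ya₊≡a₋
      where
      ya₊>0 : Positive (y * a₊)
      ya₊>0 = pos*pos⇒pos y a₊ {{a₊>0}}
      Ψ-defined : ∃ λ y′ → divM a₋ (y * a₊) ≡ just y′
      Ψ-defined = divM-defined a₋ (pos⇒≢0 (y * a₊) {{ya₊>0}})
      y′ : ℚ
      y′ = proj₁ Ψ-defined
      y′ya₊≡a₋ : y′ * (y * a₊) ≡ a₋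
      y′ya₊≡a₋ = proj₂ (divM≡just⇒ (proj₂ Ψ-defined))
      b₊>0 : Positive (1ℚ * yB₁ S y′)
      b₊>0 = pos*pos⇒pos 1ℚ (yB₁ S y′)
        {{rowPoly-pos (S p1) (NonSimple.posX nonSimple) y′ {{pos-quotient {y′} y′ya₊≡a₋ a₋>0 ya₊>0}}}}
      Φ-defined : ∃ λ x′ → divM (yB₋₁ S y′) (1ℚ * yB₁ S y′) ≡ just x′
      Φ-defined = divM-defined (yB₋₁ S y′) (pos⇒≢0 (1ℚ * yB₁ S y′) {{b₊>0}})
      ΦΨ-defined : rot S 1 (1ℚ , y) ≡ just (proj₁ Φ-defined , y′)
      ΦΨ-defined = trans (cong (λ m → (m >>= λ v → just (1ℚ , v)) >>= Φ S) (proj₂ Ψ-defined))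
                         (cong (_>>= λ u → just (u , y′)) (proj₂ Φ-defined))
      y′≡y : y′ ≡ y
      y′≡y = cong proj₂ (isId (1ℚ , y) (proj₁ Φ-defined , y′) ΦΨ-defined)

  ΦΨ≢id : ¬ IsId S 1
  ΦΨ≢id isId = pos⇒≢0 a₊ {{a₊>0}} (*-cancelˡ three {a₊} {0ℚ} (λ ()) (begin
    three * a₊                          ≡⟨ solve 1 (λ a → (con 1ℚ :+ con 1ℚ :+ con 1ℚ) :* a
                                             := (con 1ℚ :+ con 1ℚ) :* ((con 1ℚ :+ con 1ℚ) :* a) :- con 1ℚ :* (con 1ℚ :* a))
                                             refl a₊ ⟩
    two * (two * a₊) - 1ℚ * (1ℚ * a₊)   ≡⟨ cong₂ _-_ (fixed-height isId two) (fixed-height isId 1ℚ) ⟩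
    a₋ - a₋                             ≡⟨ +-inverseʳ a₋ ⟩
    0ℚ                                  ≡⟨ *-zeroʳ three ⟨
    three * 0ℚ                          ∎))
    where
    open ≡-Reasoning
    two three : ℚ
    two = 1ℚ + 1ℚ
    three = 1ℚ + 1ℚ + 1ℚ

<-of-+ : ∀ t u {m} → t ℕ.+ suc u ≡ m → t < m
<-of-+ t u refl = ℕ.m<m+n t z<s

ΦΨ : StepSet → Pt → Maybe Pt
ΦΨ S q = Ψ S q >>= Φ S

rot-front : ∀ S u q → rot S (suc u) q ≡ (ΦΨ S q >>= rot S u)
rot-front S zero    q = sym (>>=-identityʳ (ΦΨ S q))
rot-front S (suc u) q = trans (cong (_>>= ΦΨ S) (rot-front S u q)) (>>=-assoc (ΦΨ S q) (rot S u) (ΦΨ S))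

rot-+ : ∀ S u v {q r} → rot S u q ≡ just r → rot S (u ℕ.+ v) q ≡ rot S v r
rot-+ S zero    v refl = refl
rot-+ S (suc u) v {q} eq with >>=-just (ΦΨ S q) (trans (sym (rot-front S u q)) eq)
... | q′ , ΦΨq , rot-u = trans (rot-front S (u ℕ.+ v) q)
                               (trans (cong (_>>= rot S (u ℕ.+ v)) ΦΨq) (rot-+ S u v rot-u))

orbitPoint : StepSet → Pt → ℕ → Pt
orbitPoint S a k = fromMaybe a (rot S k a)

OrbitDefined : StepSet → ℕ → Pt → Set
OrbitDefined S m a = ∀ k → k < m → rot S k a ≡ just (orbitPoint S a k)

module Chain (S : StepSet) (m : ℕ) (a : Pt)
             (defined : OrbitDefined S m a) where

  open Generators S

  A A′ : ℕ → Pt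
  A     = orbitPoint S a
  A′ t  = fromMaybe (A t) (Ψ S (A t))

  private
    half-steps : ∀ {t} → suc t < m → ∃ λ e → Ψ S (A t) ≡ just e × Φ S e ≡ just (A (suc t))
    half-steps {t} t+1<m = >>=-just (Ψ S (A t))
      (trans (sym (cong (_>>= ΦΨ S) (defined t (ℕ.<-trans (ℕ.n<1+n t) t+1<m)))) (defined (suc t) t+1<m))

  Ψ-step : ∀ {t} → suc t < m → Ψ S (A t) ≡ just (A′ t)
  Ψ-step t+1<m with half-steps t+1<m
  ... | _ , Ψe , _ = fromMaybe-just Ψe

  Φ-step : ∀ {t} → suc t < m → Φ S (A′ t) ≡ just (A (suc t))
  Φ-step {t} t+1<m with half-steps t+1<m
  ... | _ , Ψe , Φe = subst (λ e → Φ S e ≡ just (A (suc t))) (cong (fromMaybe (A t)) (sym Ψe)) Φe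

  x′≡x : ∀ {t} → suc t < m → proj₁ (A′ t) ≡ proj₁ (A t)
  x′≡x {t} t+1<m = Ψ-keeps-x (A t) (Ψ-step t+1<m)

  y≡y′ : ∀ {t} → suc t < m → proj₂ (A (suc t)) ≡ proj₂ (A′ t)
  y≡y′ {t} t+1<m = Φ-keeps-y (A′ t) (Φ-step t+1<m)

  x≢0 : ∀ {t} → suc t < m → proj₁ (A t) ≢ 0ℚ
  x≢0 {t} t+1<m x≡0 = Φ-x≢0 (A′ t) (Φ-step t+1<m) (trans (x′≡x t+1<m) x≡0)

  y′≢0 : ∀ {t} → suc (suc t) < m → proj₂ (A′ t) ≢ 0ℚ
  y′≢0 {t} t+2<m y′≡0 = Ψ-y≢0 (A (suc t)) (Ψ-step t+2<m) (trans (y≡y′ (ℕ.<-trans (ℕ.n<1+n _) t+2<m)) y′≡0)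

  module _ {s : ℚ} (onLevel : OnLevel S s a) where

    OnLevel-A  : ∀ k → k < m → OnLevel S s (A k)
    OnLevel-A′ : ∀ {k} → suc k < m → OnLevel S s (A′ k)
    OnLevel-A zero    _     = onLevel
    OnLevel-A (suc k) k+1<m = Φ-OnLevel (A′ k) {s = s} (Φ-step k+1<m) (OnLevel-A′ k+1<m)
    OnLevel-A′ {k} k+1<m    = Ψ-OnLevel (A k) {s = s} (Ψ-step k+1<m) (OnLevel-A k (ℕ.<-trans (ℕ.n<1+n k) k+1<m))

  -- Undoing the steps back to a: Ψ can be inverted at A′ t′ since its y is nonzero, and Φ at A t′ since its x is.
  back : ∀ {b} → Φ S a ≡ just b → ∀ t → suc t < m → proj₂ (A′ t) ≢ 0ℚ → rot S (suc t) (A′ t) ≡ just b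
  back Φa zero    t+1<m y′≢0′ = trans (cong (_>>= Φ S) (Ψ-involutive (A 0) (Ψ-step t+1<m) y′≢0′)) Φa
  back Φa (suc t) t+1<m y′≢0′ = begin
    rot S (suc (suc t)) (A′ (suc t))        ≡⟨ rot-front S (suc t) (A′ (suc t)) ⟩
    (ΦΨ S (A′ (suc t)) >>= rot S (suc t))   ≡⟨ cong (_>>= rot S (suc t)) ΦΨA′ ⟩
    rot S (suc t) (A′ t)                    ≡⟨ back Φa t t<m (y′≢0 t+1<m) ⟩
    just _                                  ∎
    where
    open ≡-Reasoning
    t<m = ℕ.<-trans (ℕ.n<1+n (suc t)) t+1<m
    ΦΨA′ : ΦΨ S (A′ (suc t)) ≡ just (A′ t)
    ΦΨA′ = trans (cong (_>>= Φ S) (Ψ-involutive (A (suc t)) (Ψ-step t+1<m) y′≢0′))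
                 (Φ-involutive (A′ t) (Φ-step t<m) (x≢0 t+1<m))

-- Going back t + 1 steps from A′ t reaches b = Φ a; going m steps is the identity, so A′ t is
-- the point u = m − (t + 1) steps after b.
module Meet (S : StepSet) (m : ℕ) (isId : IsId S m) (a b : Pt) (Φa : Φ S a ≡ just b)
            (A-defined : OrbitDefined S m a)
            (B-defined : OrbitDefined S m b) where

  open Chain S m a A-defined

  meet : ∀ t u → suc t ℕ.+ u ≡ m → suc t < m → proj₂ (A′ t) ≢ 0ℚ → A′ t ≡ orbitPoint S b u
  meet t u t+1+u≡m t+1<m y′≢0 = sym (isId (A′ t) _ (begin
    rot S m (A′ t)             ≡⟨ cong (λ k → rot S k (A′ t)) t+1+u≡m ⟨
    rot S (suc t ℕ.+ u) (A′ t) ≡⟨ rot-+ S (suc t) u (back Φa t t+1<m y′≢0) ⟩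
    rot S u b                  ≡⟨ B-defined u (subst (u <_) t+1+u≡m (ℕ.m<n+m u z<s)) ⟩
    just (orbitPoint S b u)    ∎))
    where open ≡-Reasoning

module Pairing (S : StepSet) (m : ℕ) (isId : IsId S m) {s : ℚ} (a b : Pt)
               (Φa : Φ S a ≡ just b) (Φb : Φ S b ≡ just a)
               (A-defined : OrbitDefined S m a)
               (B-defined : OrbitDefined S m b)
               (a-onLevel : OnLevel S s a) where

  module CA = Chain S m a A-defined
  module CB = Chain S m b B-defined
  open Meet S m isId a b Φa A-defined B-defined renaming (meet to meetᴬ)
  open Meet S m isId b a Φb B-defined A-defined renaming (meet to meetᴮ)

  private
    b-onLevel : OnLevel S s b
    b-onLevel = Generators.Φ-OnLevel S a {s = s} Φa a-onLevel

    swap-sum : ∀ {t u} → suc t ℕ.+ suc u ≡ m → suc u ℕ.+ suc t ≡ m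
    swap-sum {t} {u} eq = trans (ℕ.+-comm (suc u) (suc t)) eq

  pairY : ∀ t u → suc t ℕ.+ suc u ≡ m → proj₂ (CA.A (suc t)) ≡ proj₂ (CB.A (suc u))
  pairY t u eq with proj₂ (CA.A′ t) ≟ 0ℚ | proj₂ (CB.A′ u) ≟ 0ℚ
  ... | no yA≢0 | _ =
    trans (CA.y≡y′ (<-of-+ (suc t) u eq)) (cong proj₂ (meetᴬ t (suc u) eq (<-of-+ (suc t) u eq) yA≢0))
  ... | yes _ | no yB≢0 =
    sym (trans (CB.y≡y′ (<-of-+ (suc u) t (swap-sum eq)))
               (cong proj₂ (meetᴮ u (suc t) (swap-sum eq) (<-of-+ (suc u) t (swap-sum eq)) yB≢0)))
  ... | yes yA≡0 | yes yB≡0 =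
    trans (trans (CA.y≡y′ (<-of-+ (suc t) u eq)) yA≡0)
          (sym (trans (CB.y≡y′ (<-of-+ (suc u) t (swap-sum eq))) yB≡0))

  -- If A′ t lies on the x-axis, the walk back is blocked; but then α vanishes at its x, and also at the
  -- x of its partner, since otherwise walking back from B′ u would reach A (suc t), which has y = 0.
  module _ (α : ℚ → ℚ) (vanish : ∀ q → OnLevel S s q → proj₂ q ≡ 0ℚ → α (proj₁ q) ≡ 0ℚ) where

    private
      vanish-B : ∀ t u → suc t ℕ.+ suc u ≡ m → proj₂ (CA.A′ t) ≡ 0ℚ → α (proj₁ (CB.A (suc u))) ≡ 0ℚ
      vanish-B t u eq yA≡0 with proj₂ (CB.A′ u) ≟ 0ℚ
      ... | yes yB≡0 = vanish (CB.A (suc u)) (CB.OnLevel-A {s = s} b-onLevel (suc u) u+1<m) (trans (CB.y≡y′ u+1<m) yB≡0)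
        where u+1<m = <-of-+ (suc u) t (swap-sum eq)
      ... | no yB≢0 = ⊥-elim (yB≢0 (begin
        proj₂ (CB.A′ u)        ≡⟨ cong proj₂ (meetᴮ u (suc t) (swap-sum eq) (<-of-+ (suc u) t (swap-sum eq)) yB≢0) ⟩
        proj₂ (CA.A (suc t))   ≡⟨ CA.y≡y′ (<-of-+ (suc t) u eq) ⟩
        proj₂ (CA.A′ t)        ≡⟨ yA≡0 ⟩
        0ℚ                     ∎))
        where open ≡-Reasoning

    pairX : ∀ t u → suc t ℕ.+ suc u ≡ m → α (proj₁ (CA.A t)) ≡ α (proj₁ (CB.A (suc u)))
    pairX t u eq with proj₂ (CA.A′ t) ≟ 0ℚ
    ... | no yA≢0 = cong α (trans (sym (CA.x′≡x t+1<m)) (cong proj₁ (meetᴬ t (suc u) eq t+1<m yA≢0)))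
      where t+1<m = <-of-+ (suc t) u eq
    ... | yes yA≡0 = trans
      (subst (λ x → α x ≡ 0ℚ) (CA.x′≡x t+1<m) (vanish (CA.A′ t) (CA.OnLevel-A′ {s = s} a-onLevel t+1<m) yA≡0))
      (sym (vanish-B t u eq yA≡0))
      where t+1<m = <-of-+ (suc t) u eq

sumTo-cong : ∀ N {f g : ℕ → ℚ} → (∀ k → f k ≡ g k) → sumTo N f ≡ sumTo N g
sumTo-cong zero    f≗g = refl
sumTo-cong (suc N) f≗g = cong₂ _+_ (sumTo-cong N f≗g) (f≗g N)

sumTo-cong< : ∀ m {f g : ℕ → ℚ} → (∀ k → k < m → f k ≡ g k) → sumTo m f ≡ sumTo m g
sumTo-cong< zero    f≗g = refl
sumTo-cong< (suc m) f≗g = cong₂ _+_ (sumTo-cong< m (λ k k<m → f≗g k (ℕ.m<n⇒m<1+n k<m))) (f≗g m (ℕ.n<1+n m))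

sumTo-zero : ∀ N → sumTo N (λ _ → 0ℚ) ≡ 0ℚ
sumTo-zero zero    = refl
sumTo-zero (suc N) = trans (+-identityʳ _) (sumTo-zero N)

sumTo-shift : ∀ m (f : ℕ → ℚ) → sumTo (suc m) f ≡ f 0 + sumTo m (f ∘ suc)
sumTo-shift zero    f = trans (+-identityˡ (f 0)) (sym (+-identityʳ (f 0)))
sumTo-shift (suc m) f = trans (cong (_+ f (suc m)) (sumTo-shift m f)) (+-assoc (f 0) _ (f (suc m)))

sumTo-reverse : ∀ m {f g : ℕ → ℚ} → (∀ k u → suc k ℕ.+ u ≡ m → f k ≡ g u) → sumTo m f ≡ sumTo m g
sumTo-reverse zero    _    = refl
sumTo-reverse (suc m) {f} {g} pair = begin
  sumTo m f + f m           ≡⟨ cong₂ _+_ (sumTo-reverse m (λ k u eq → pair k (suc u) (trans (ℕ.+-suc (suc k) u) (cong suc eq))))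
                                         (pair m 0 (cong suc (ℕ.+-identityʳ m))) ⟩
  sumTo m (g ∘ suc) + g 0   ≡⟨ +-comm _ (g 0) ⟩
  g 0 + sumTo m (g ∘ suc)   ≡⟨ sumTo-shift m g ⟨
  sumTo (suc m) g           ∎
  where open ≡-Reasoning

sumTo-− : ∀ m (f g : ℕ → ℚ) → sumTo m (λ k → f k - g k) ≡ sumTo m f - sumTo m g
sumTo-− zero    f g = refl
sumTo-− (suc m) f g = trans (cong (_+ (f m - g m)) (sumTo-− m f g))
  (solve 4 (λ F G f g → (F :- G) :+ (f :- g) := (F :+ f) :- (G :+ g)) refl (sumTo m f) (sumTo m g) (f m) (g m))

sumTo-linear : ∀ m s (f g h : ℕ → ℚ) →
  sumTo m (λ k → s * f k - g k - h k) ≡ s * sumTo m f - sumTo m g - sumTo m h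
sumTo-linear zero    s f g h = solve 1 (λ s → con 0ℚ := s :* con 0ℚ :- con 0ℚ :- con 0ℚ) refl s
sumTo-linear (suc m) s f g h = trans (cong (_+ (s * f m - g m - h m)) (sumTo-linear m s f g h))
  (solve 7 (λ s F G H f g h → (s :* F :- G :- H) :+ (s :* f :- g :- h) := s :* (F :+ f) :- (G :+ g) :- (H :+ h))
    refl s (sumTo m f) (sumTo m g) (sumTo m h) (f m) (g m) (h m))

-- Σ_g sign(g) F(g p), with g = (ΦΨ)ᵏ of sign +1 and g = (ΦΨ)ᵏ Φ of sign −1, where b = Φ p
orbitSum : StepSet → ℕ → Pt → Pt → (Pt → ℚ) → ℚ
orbitSum S m p b F = sumTo m (λ k → F (orbitPoint S p k) - F (orbitPoint S b k))

module Orbit (S : StepSet) (m₀ : ℕ) (isId : IsId S (suc (suc m₀))) {s : ℚ} (p b : Pt) (Φp : Φ S p ≡ just b)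
             (C-defined : OrbitDefined S (suc (suc m₀)) p)
             (D-defined : OrbitDefined S (suc (suc m₀)) b)
             (p-onLevel : OnLevel S s p) where

  private
    m = suc (suc m₀)
    open Generators S

    Φb : Φ S b ≡ just p
    Φb = Φ-involutive p Φp (Chain.x≢0 S m b D-defined {0} (s<s z<s))

    b-onLevel : OnLevel S s b
    b-onLevel = Φ-OnLevel p {s = s} Φp p-onLevel

    module P  = Pairing S m isId {s} p b Φp Φb C-defined D-defined p-onLevel
    module P′ = Pairing S m isId {s} b p Φb Φp D-defined C-defined b-onLevel

    C D : ℕ → Pt
    C = orbitPoint S p
    D = orbitPoint S b

    orbitSum-zero : ∀ (F : Pt → ℚ) → sumTo m (F ∘ C) ≡ sumTo m (F ∘ D) → orbitSum S m p b F ≡ 0ℚ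
    orbitSum-zero F ΣC≡ΣD = trans (sumTo-− m (F ∘ C) (F ∘ D))
      (trans (cong (_- sumTo m (F ∘ D)) ΣC≡ΣD) (+-inverseʳ (sumTo m (F ∘ D))))

  orbitSum-y : ∀ (β : ℚ → ℚ) → orbitSum S m p b (β ∘ proj₂) ≡ 0ℚ
  orbitSum-y β = orbitSum-zero (β ∘ proj₂) (begin
    sumTo m (β ∘ proj₂ ∘ C)                              ≡⟨ sumTo-shift (suc m₀) (β ∘ proj₂ ∘ C) ⟩
    β (proj₂ p) + sumTo (suc m₀) (β ∘ proj₂ ∘ C ∘ suc)   ≡⟨ cong₂ _+_ (cong β (sym (Φ-keeps-y p Φp)))
                                                                       (sumTo-reverse (suc m₀) pair) ⟩
    β (proj₂ b) + sumTo (suc m₀) (β ∘ proj₂ ∘ D ∘ suc)   ≡⟨ sumTo-shift (suc m₀) (β ∘ proj₂ ∘ D) ⟨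
    sumTo m (β ∘ proj₂ ∘ D)                              ∎)
    where
    open ≡-Reasoning
    pair : ∀ k u → suc k ℕ.+ u ≡ suc m₀ → β (proj₂ (C (suc k))) ≡ β (proj₂ (D (suc u)))
    pair k u eq = cong β (P.pairY k u (trans (ℕ.+-suc (suc k) u) (cong suc eq)))

  orbitSum-x : ∀ (α : ℚ → ℚ) → (∀ q → OnLevel S s q → proj₂ q ≡ 0ℚ → α (proj₁ q) ≡ 0ℚ) →
               orbitSum S m p b (α ∘ proj₁) ≡ 0ℚ
  orbitSum-x α vanish = orbitSum-zero (α ∘ proj₁) (sumTo-reverse m pair)
    where
    pair : ∀ k u → suc k ℕ.+ u ≡ m → α (proj₁ (C k)) ≡ α (proj₁ (D u))
    pair k (suc u) eq = P.pairX α vanish k u eq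
    pair k zero    eq with ℕ.suc-injective (trans (sym (ℕ.+-identityʳ (suc k))) eq)
    ... | refl = sym (P′.pairX α vanish 0 m₀ refl)

  orbitSum-recurrence : ∀ (F G : Pt → ℚ) (α β : ℚ → ℚ) κ →
    (∀ q → OnLevel S s q → proj₂ q ≡ 0ℚ → α (proj₁ q) ≡ 0ℚ) →
    (∀ q → OnLevel S s q → F q ≡ s * G q - α (proj₁ q) - β (proj₂ q) + κ) →
    orbitSum S m p b F ≡ s * orbitSum S m p b G
  orbitSum-recurrence F G α β κ vanish recurrence = begin
    orbitSum S m p b F
      ≡⟨ sumTo-cong< m (λ k k<m → trans (cong₂ _-_ (recurrence (C k) (P.CA.OnLevel-A {s = s} p-onLevel k k<m))
                                                   (recurrence (D k) (P.CB.OnLevel-A {s = s} b-onLevel k k<m)))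
                                          (regroup (G (C k)) (G (D k)) (α (proj₁ (C k))) (α (proj₁ (D k)))
                                                   (β (proj₂ (C k))) (β (proj₂ (D k))))) ⟩
    sumTo m (λ k → s * Δ G k - Δ (α ∘ proj₁) k - Δ (β ∘ proj₂) k)
      ≡⟨ sumTo-linear m s (Δ G) (Δ (α ∘ proj₁)) (Δ (β ∘ proj₂)) ⟩
    s * orbitSum S m p b G - orbitSum S m p b (α ∘ proj₁) - orbitSum S m p b (β ∘ proj₂)
      ≡⟨ cong₂ (λ x y → s * orbitSum S m p b G - x - y) (orbitSum-x α vanish) (orbitSum-y β) ⟩
    s * orbitSum S m p b G - 0ℚ - 0ℚ
      ≡⟨ solve 1 (λ x → x :- con 0ℚ :- con 0ℚ := x) refl (s * orbitSum S m p b G) ⟩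
    s * orbitSum S m p b G ∎
    where
    open ≡-Reasoning
    Δ : (Pt → ℚ) → ℕ → ℚ
    Δ H k = H (C k) - H (D k)
    regroup : ∀ gC gD aC aD bC bD →
      (s * gC - aC - bC + κ) - (s * gD - aD - bD + κ) ≡ s * (gC - gD) - (aC - aD) - (bC - bD)
    regroup = solve 8 (λ s κ gC gD aC aD bC bD →
      (s :* gC :- aC :- bC :+ κ) :- (s :* gD :- aD :- bD :+ κ)
      := s :* (gC :- gD) :- (aC :- aD) :- (bC :- bD)) refl s κ

private
  variable
    A B : Set

sumL : List A → (A → ℚ) → ℚ
sumL []       f = 0ℚ
sumL (a ∷ as) f = f a + sumL as f

sumL-cong : ∀ (L : List A) {f g : A → ℚ} → (∀ a → f a ≡ g a) → sumL L f ≡ sumL L g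
sumL-cong []      f≗g = refl
sumL-cong (a ∷ L) f≗g = cong₂ _+_ (f≗g a) (sumL-cong L f≗g)

sumL-zero : ∀ (L : List A) → sumL L (λ _ → 0ℚ) ≡ 0ℚ
sumL-zero []      = refl
sumL-zero (a ∷ L) = trans (+-identityˡ _) (sumL-zero L)

sumL-++ : ∀ (L M : List A) f → sumL (L ++ M) f ≡ sumL L f + sumL M f
sumL-++ []      M f = sym (+-identityˡ _)
sumL-++ (a ∷ L) M f = trans (cong (f a +_) (sumL-++ L M f)) (sym (+-assoc (f a) _ _))

sumL-concatMap : ∀ (g : A → List B) L (f : B → ℚ) → sumL (concatMap g L) f ≡ sumL L (λ a → sumL (g a) f)
sumL-concatMap g []      f = refl
sumL-concatMap g (a ∷ L) f = trans (sumL-++ (g a) (concatMap g L) f) (cong (sumL (g a) f +_) (sumL-concatMap g L f))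

sumL-map : ∀ (g : A → B) L (f : B → ℚ) → sumL (map g L) f ≡ sumL L (f ∘ g)
sumL-map g []      f = refl
sumL-map g (a ∷ L) f = cong (f (g a) +_) (sumL-map g L f)

sumL-+ : ∀ (L : List A) f g → sumL L (λ a → f a + g a) ≡ sumL L f + sumL L g
sumL-+ []      f g = refl
sumL-+ (a ∷ L) f g = trans (cong (f a + g a +_) (sumL-+ L f g))
  (solve 4 (λ a b c d → (a :+ b) :+ (c :+ d) := (a :+ c) :+ (b :+ d)) refl (f a) (g a) (sumL L f) (sumL L g))

sumL-*ˡ : ∀ (L : List A) k f → sumL L (λ a → k * f a) ≡ k * sumL L f
sumL-*ˡ []      k f = sym (*-zeroʳ k)
sumL-*ˡ (a ∷ L) k f = trans (cong (k * f a +_) (sumL-*ˡ L k f)) (sym (*-distribˡ-+ k (f a) _))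

sumL-*ʳ : ∀ (L : List A) k f → sumL L (λ a → f a * k) ≡ sumL L f * k
sumL-*ʳ []      k f = sym (*-zeroˡ k)
sumL-*ʳ (a ∷ L) k f = trans (cong (f a * k +_) (sumL-*ʳ L k f)) (sym (*-distribʳ-+ k (f a) _))

sumL-swap : ∀ (L : List A) (M : List B) (h : A → B → ℚ) →
            sumL L (λ a → sumL M (h a)) ≡ sumL M (λ b → sumL L (λ a → h a b))
sumL-swap []      M h = sym (sumL-zero M)
sumL-swap (a ∷ L) M h = trans (cong (sumL M (h a) +_) (sumL-swap L M h)) (sym (sumL-+ M (h a) _))

sumTo-sumL : ∀ N (L : List A) (h : ℕ → A → ℚ) →
             sumTo N (λ i → sumL L (h i)) ≡ sumL L (λ a → sumTo N (λ i → h i a))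
sumTo-sumL zero    L h = sym (sumL-zero L)
sumTo-sumL (suc N) L h = trans (cong (_+ sumL L (h N)) (sumTo-sumL N L h)) (sym (sumL-+ L _ (h N)))

sumL-filter : ∀ (P : A → Bool) L f → sumL (filterᵇ P L) f ≡ sumL L (λ a → indicator (P a) * f a)
sumL-filter P []      f = refl
sumL-filter P (a ∷ L) f with P a
... | true  = cong₂ _+_ (sym (*-identityˡ (f a))) (sumL-filter P L f)
... | false = trans (sumL-filter P L f) (sym (trans (cong (_+ _) (*-zeroˡ (f a))) (+-identityˡ _)))

fromℕ-suc : ∀ k → fromℕ (suc k) ≡ 1ℚ + fromℕ k
fromℕ-suc k = toℚᵘ-injective (ℚᵘ.≃-trans (ℚᵘ.*≡* numerators) (ℚᵘ.≃-sym (toℚᵘ-homo-+ 1ℚ (fromℕ k))))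
  where
  numerators : ℤ.+ suc k ℤ.* ℤ.+ 1 ≡ (ℤ.+ 1 ℤ.* ℤ.+ 1 ℤ.+ ℤ.+ k ℤ.* ℤ.+ 1) ℤ.* ℤ.+ 1
  numerators = cong (λ t → (ℤ.+ 1 ℤ.+ t) ℤ.* ℤ.+ 1) (sym (ℤ.*-identityʳ (ℤ.+ k)))

length-filter : ∀ (P : A → Bool) L → fromℕ (length (filterᵇ P L)) ≡ sumL L (indicator ∘ P)
length-filter P []      = refl
length-filter P (a ∷ L) with P a
... | true  = trans (fromℕ-suc _) (cong (1ℚ +_) (length-filter P L))
... | false = trans (length-filter P L) (sym (+-identityˡ _))

sumL-words-suc : ∀ S n (f : List Step → ℚ) →
                 sumL (words S (suc n)) f ≡ sumL (words S n) (λ w → sumL (steps S) (λ s → f (s ∷ w)))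
sumL-words-suc S n f = trans (sumL-concatMap _ (words S n) f)
                             (sumL-cong (words S n) (λ w → sumL-map (_∷ w) (steps S) f))

sumL-words-cong : ∀ S n {f g : List Step → ℚ} → (∀ w → length w ≡ n → f w ≡ g w) →
                  sumL (words S n) f ≡ sumL (words S n) g
sumL-words-cong S zero    f≗g = cong (_+ 0ℚ) (f≗g [] refl)
sumL-words-cong S (suc n) f≗g = trans (sumL-words-suc S n _) (trans
  (sumL-words-cong S n (λ w |w|≡n → sumL-cong (steps S) (λ s → f≗g (s ∷ w) (cong suc |w|≡n))))
  (sym (sumL-words-suc S n _)))

-- words prepends the new step; the kernel equation needs the words grouped by their last step.
sumL-words-snoc : ∀ S n (f : List Step → ℚ) →
                  sumL (words S (suc n)) f ≡ sumL (words S n) (λ w → sumL (steps S) (λ s → f (w ++ s ∷ [])))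
sumL-words-snoc S n f = trans (sumL-words-suc S n f) (prepend≡append n f)
  where
  prepend≡append : ∀ n (f : List Step → ℚ) →
    sumL (words S n) (λ w → sumL (steps S) (λ s → f (s ∷ w))) ≡
    sumL (words S n) (λ w → sumL (steps S) (λ s → f (w ++ s ∷ [])))
  prepend≡append zero    f = refl
  prepend≡append (suc n) f = begin
    sumL (words S (suc n)) (λ w → sumL (steps S) (λ s → f (s ∷ w)))
      ≡⟨ sumL-words-suc S n _ ⟩
    sumL (words S n) (λ w → sumL (steps S) (λ s′ → sumL (steps S) (λ s → f (s ∷ s′ ∷ w))))
      ≡⟨ prepend≡append n (λ v → sumL (steps S) (λ s → f (s ∷ v))) ⟩
    sumL (words S n) (λ w → sumL (steps S) (λ s′ → sumL (steps S) (λ s → f (s ∷ w ++ s′ ∷ []))))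
      ≡⟨ sumL-cong (words S n) (λ w → sumL-swap (steps S) (steps S) (λ s′ s → f (s ∷ w ++ s′ ∷ []))) ⟩
    sumL (words S n) (λ w → sumL (steps S) (λ s → sumL (steps S) (λ s′ → f (s ∷ w ++ s′ ∷ []))))
      ≡⟨ sumL-words-suc S n _ ⟨
    sumL (words S (suc n)) (λ w → sumL (steps S) (λ s → f (w ++ s ∷ []))) ∎
    where open ≡-Reasoning

shift : V → ℕ → Maybe ℕ
shift m1 zero    = nothing
shift m1 (suc a) = just a
shift z  a       = just a
shift p1 a       = just (suc a)

shift-≤ : ∀ u a {a′} → shift u a ≡ just a′ → a′ ≤ suc a
shift-≤ m1 (suc a) refl = ℕ.≤-trans (ℕ.n≤1+n a) (ℕ.n≤1+n (suc a))
shift-≤ z  a       refl = ℕ.n≤1+n a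
shift-≤ p1 a       refl = ℕ.≤-refl

move : Step → ℕ × ℕ → Maybe (ℕ × ℕ)
move (u , v) (a , b) = shift u a >>= λ a′ → shift v b >>= λ b′ → just (a′ , b′)

endpoint : ℕ × ℕ → List Step → Maybe (ℕ × ℕ)
endpoint c []      = just c
endpoint c (s ∷ w) = move s c >>= λ c′ → endpoint c′ w

endpoint-snoc : ∀ c w s → endpoint c (w ++ s ∷ []) ≡ (endpoint c w >>= move s)
endpoint-snoc c []       s = >>=-identityʳ (move s c)
endpoint-snoc c (s′ ∷ w) s = trans (>>=-cong (move s′ c) (λ c′ → endpoint-snoc c′ w s))
                                   (sym (>>=-assoc (move s′ c) (λ c′ → endpoint c′ w) (move s)))

endpoint-bounded : ∀ w {a b i j} → endpoint (a , b) w ≡ just (i , j) → i ≤ a ℕ.+ length w × j ≤ b ℕ.+ length w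
endpoint-bounded []            {a} {b} refl = ℕ.m≤m+n a 0 , ℕ.m≤m+n b 0
endpoint-bounded ((u , v) ∷ w) {a} {b} eq with shift u a in su | shift v b in sv
... | just a′ | just b′ with endpoint-bounded w eq
...   | i≤ , j≤ = ℕ.≤-trans i≤ (grow u a su) , ℕ.≤-trans j≤ (grow v b sv)
  where
  grow : ∀ u a {a′} → shift u a ≡ just a′ → a′ ℕ.+ length w ≤ a ℕ.+ suc (length w)
  grow u a su = ℕ.≤-trans (ℕ.+-monoˡ-≤ (length w) (shift-≤ u a su)) (ℕ.≤-reflexive (sym (ℕ.+-suc a (length w))))

_≐_ : ℕ → ℕ → Bool
a ≐ i = eqℤ (ℤ.+ a) (ℤ.+ i)

isAt : Maybe (ℕ × ℕ) → ℕ → ℕ → Bool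
isAt nothing        i j = false
isAt (just (a , b)) i j = (a ≐ i) ∧ (b ≐ j)

private
  shiftℤ : Maybe ℕ → ℤ.ℤ
  shiftℤ = maybe′ ℤ.+_ (ℤ.-[1+ 0 ])

  +-val : ∀ u a → ℤ.+ a ℤ.+ val u ≡ shiftℤ (shift u a)
  +-val m1 zero    = refl
  +-val m1 (suc a) = refl
  +-val z  a       = cong ℤ.+_ (ℕ.+-identityʳ a)
  +-val p1 a       = cong ℤ.+_ (ℕ.+-comm a 1)

quadWalk-endpoint : ∀ w a b i j → quadWalk (ℤ.+ a) (ℤ.+ b) w (ℤ.+ i) (ℤ.+ j) ≡ isAt (endpoint (a , b) w) i j
quadWalk-endpoint []            a b i j = refl
quadWalk-endpoint ((u , v) ∷ w) a b i j rewrite +-val u a | +-val v b with shift u a | shift v b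
... | nothing | _       = refl
... | just a′ | nothing = refl
... | just a′ | just b′ = quadWalk-endpoint w a′ b′ i j

≐-suc : ∀ a i → (suc a ≐ suc i) ≡ (a ≐ i)
≐-suc zero    zero    = refl
≐-suc zero    (suc i) = refl
≐-suc (suc a) zero    = refl
≐-suc (suc a) (suc i) = refl

≐-refl : ∀ a → (a ≐ a) ≡ true
≐-refl zero    = refl
≐-refl (suc a) = trans (≐-suc a a) (≐-refl a)

≐-≢ : ∀ {a i} → a ≢ i → (a ≐ i) ≡ false
≐-≢ {zero}  {zero}  a≢i = ⊥-elim (a≢i refl)
≐-≢ {zero}  {suc i} a≢i = refl
≐-≢ {suc a} {zero}  a≢i = refl
≐-≢ {suc a} {suc i} a≢i = trans (≐-suc a i) (≐-≢ (a≢i ∘ cong suc))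

private
  ≐-≢-term : ∀ {a i} → a ≢ i → ∀ t → indicator (a ≐ i) * t ≡ 0ℚ
  ≐-≢-term a≢i t = trans (cong (λ b → indicator b * t) (≐-≢ a≢i)) (*-zeroˡ t)

  sumTo-delta-outside : ∀ N a (t : ℕ → ℚ) → N ≤ a → sumTo N (λ i → indicator (a ≐ i) * t i) ≡ 0ℚ
  sumTo-delta-outside zero    a t _     = refl
  sumTo-delta-outside (suc N) a t N+1≤a =
    trans (cong₂ _+_ (sumTo-delta-outside N a t (ℕ.<⇒≤ N+1≤a)) (≐-≢-term (ℕ.>⇒≢ N+1≤a) (t N))) (+-identityʳ 0ℚ)

sumTo-delta : ∀ N a (t : ℕ → ℚ) → a < N → sumTo N (λ i → indicator (a ≐ i) * t i) ≡ t a
sumTo-delta (suc N) a t a<N+1 with a ℕ.≟ N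
... | yes refl = trans (cong₂ _+_ (sumTo-delta-outside N a t ℕ.≤-refl) (cong (λ b → indicator b * t a) (≐-refl a)))
                       (trans (+-identityˡ _) (*-identityˡ (t a)))
... | no a≢N   = trans (cong₂ _+_ (sumTo-delta N a t (ℕ.≤∧≢⇒< (ℕ.≤-pred a<N+1) a≢N)) (≐-≢-term a≢N (t N)))
                       (+-identityʳ (t a))

valueAt : (ℕ → ℕ → ℚ) → Maybe (ℕ × ℕ) → ℚ
valueAt g = maybe′ (uncurry g) 0ℚ

sumBox : ℕ → (ℕ → ℕ → ℚ) → ℚ
sumBox N h = sumTo N (λ i → sumTo N (h i))

sumTo-indicator-∧ : ∀ b N (B : ℕ → Bool) (t : ℕ → ℚ) →
  sumTo N (λ j → indicator (b ∧ B j) * t j) ≡ indicator b * sumTo N (λ j → indicator (B j) * t j)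
sumTo-indicator-∧ true  N B t = sym (*-identityˡ _)
sumTo-indicator-∧ false N B t =
  trans (trans (sumTo-cong N (λ j → *-zeroˡ (t j))) (sumTo-zero N)) (sym (*-zeroˡ (sumTo N (λ j → indicator (B j) * t j))))

sumBox-isAt : ∀ N g e → (∀ {i j} → e ≡ just (i , j) → i < N × j < N) →
              sumBox N (λ i j → indicator (isAt e i j) * g i j) ≡ valueAt g e
sumBox-isAt N g nothing _ =
  trans (sumTo-cong N (λ i → trans (sumTo-cong N (λ j → *-zeroˡ (g i j))) (sumTo-zero N))) (sumTo-zero N)
sumBox-isAt N g (just (a , b)) inBox = begin
  sumBox N (λ i j → indicator ((a ≐ i) ∧ (b ≐ j)) * g i j)
    ≡⟨ sumTo-cong N (λ i → sumTo-indicator-∧ (a ≐ i) N (b ≐_) (g i)) ⟩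
  sumTo N (λ i → indicator (a ≐ i) * sumTo N (λ j → indicator (b ≐ j) * g i j))
    ≡⟨ sumTo-delta N a _ (proj₁ (inBox refl)) ⟩
  sumTo N (λ j → indicator (b ≐ j) * g a j)
    ≡⟨ sumTo-delta N b _ (proj₂ (inBox refl)) ⟩
  g a b ∎
  where open ≡-Reasoning

-- the coefficient of tⁿ in Q(x,y;t), so that xyQ S n (x , y) = x * y * Qₙ S n x y
Qₙ : StepSet → ℕ → ℚ → ℚ → ℚ
Qₙ S n x y = sumBox (suc n) (λ i j → fromℕ (q S i j n) * pow x i * pow y j)

monomial : ℚ → ℚ → ℕ → ℕ → ℚ
monomial x y i j = pow x i * pow y j

Qₙ-by-walks : ∀ S n x y → Qₙ S n x y ≡ sumL (words S n) (valueAt (monomial x y) ∘ endpoint (0 , 0))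
Qₙ-by-walks S n x y = begin
  Qₙ S n x y
    ≡⟨ sumTo-cong (suc n) (λ i → sumTo-cong (suc n) (λ j → count-walks i j)) ⟩
  sumBox (suc n) (λ i j → sumL W (λ w → ends w i j))
    ≡⟨ sumTo-cong (suc n) (λ i → sumTo-sumL (suc n) W (λ j w → ends w i j)) ⟩
  sumTo (suc n) (λ i → sumL W (λ w → sumTo (suc n) (ends w i)))
    ≡⟨ sumTo-sumL (suc n) W (λ i w → sumTo (suc n) (ends w i)) ⟩
  sumL W (λ w → sumBox (suc n) (ends w))
    ≡⟨ sumL-words-cong S n (λ w |w|≡n → sumBox-isAt (suc n) (monomial x y) (endpoint (0 , 0) w) (inBox w |w|≡n)) ⟩
  sumL W (valueAt (monomial x y) ∘ endpoint (0 , 0)) ∎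
  where
  open ≡-Reasoning
  W : List (List Step)
  W = words S n
  ends : List Step → ℕ → ℕ → ℚ
  ends w i j = indicator (isAt (endpoint (0 , 0) w) i j) * monomial x y i j
  count-walks : ∀ i j → fromℕ (q S i j n) * pow x i * pow y j ≡ sumL W (λ w → ends w i j)
  count-walks i j = begin
    fromℕ (q S i j n) * pow x i * pow y j
      ≡⟨ *-assoc (fromℕ (q S i j n)) (pow x i) (pow y j) ⟩
    fromℕ (q S i j n) * monomial x y i j
      ≡⟨ cong (_* monomial x y i j) (length-filter _ W) ⟩
    sumL W (λ w → indicator (quadWalk (ℤ.+ 0) (ℤ.+ 0) w (ℤ.+ i) (ℤ.+ j))) * monomial x y i j
      ≡⟨ sumL-*ʳ W (monomial x y i j) _ ⟨
    sumL W (λ w → indicator (quadWalk (ℤ.+ 0) (ℤ.+ 0) w (ℤ.+ i) (ℤ.+ j)) * monomial x y i j)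
      ≡⟨ sumL-cong W (λ w → cong (λ b → indicator b * monomial x y i j) (quadWalk-endpoint w 0 0 i j)) ⟩
    sumL W (λ w → ends w i j) ∎
  inBox : ∀ w → length w ≡ n → ∀ {i j} → endpoint (0 , 0) w ≡ just (i , j) → i < suc n × j < suc n
  inBox w refl end with endpoint-bounded w end
  ... | i≤ , j≤ = s≤s i≤ , s≤s j≤

-- x y Qₙ₊₁ in terms of F = Qₙ
kernelCombination : StepSet → ℚ → ℚ → (ℚ → ℚ → ℚ) → ℚ
kernelCombination S x y F =
  xyS S x y * F x y - xA₋₁ S x * F x 0ℚ - yB₋₁ S y * F 0ℚ y + c S m1 m1 * F 0ℚ 0ℚ

kernelCombination-cong : ∀ S x y {F G : ℚ → ℚ → ℚ} → (∀ u v → F u v ≡ G u v) →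
                         kernelCombination S x y F ≡ kernelCombination S x y G
kernelCombination-cong S x y F≗G =
  cong₂ _+_ (cong₂ _-_ (cong₂ _-_ (cong (xyS S x y *_) (F≗G x y)) (cong (xA₋₁ S x *_) (F≗G x 0ℚ)))
                       (cong (yB₋₁ S y *_) (F≗G 0ℚ y)))
            (cong (c S m1 m1 *_) (F≗G 0ℚ 0ℚ))

kernelCombination-zero : ∀ S x y → kernelCombination S x y (λ _ _ → 0ℚ) ≡ 0ℚ
kernelCombination-zero S x y =
  solve 4 (λ s a b d → s :* con 0ℚ :- a :* con 0ℚ :- b :* con 0ℚ :+ d :* con 0ℚ := con 0ℚ) refl
    (xyS S x y) (xA₋₁ S x) (yB₋₁ S y) (c S m1 m1)

sumL-kernelCombination : ∀ S x y (L : List A) (F : A → ℚ → ℚ → ℚ) →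
  sumL L (λ a → kernelCombination S x y (F a)) ≡ kernelCombination S x y (λ u v → sumL L (λ a → F a u v))
sumL-kernelCombination S x y []      F = sym (kernelCombination-zero S x y)
sumL-kernelCombination S x y (a ∷ L) F =
  trans (cong (kernelCombination S x y (F a) +_) (sumL-kernelCombination S x y L F))
    (solve 12 (λ s α β γ f₁ f₂ f₃ f₄ g₁ g₂ g₃ g₄ →
       (s :* f₁ :- α :* f₂ :- β :* f₃ :+ γ :* f₄) :+ (s :* g₁ :- α :* g₂ :- β :* g₃ :+ γ :* g₄)
       := s :* (f₁ :+ g₁) :- α :* (f₂ :+ g₂) :- β :* (f₃ :+ g₃) :+ γ :* (f₄ :+ g₄)) refl
       (xyS S x y) (xA₋₁ S x) (yB₋₁ S y) (c S m1 m1)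
       (F a x y) (F a x 0ℚ) (F a 0ℚ y) (F a 0ℚ 0ℚ)
       (sumL L (λ a → F a x y)) (sumL L (λ a → F a x 0ℚ)) (sumL L (λ a → F a 0ℚ y)) (sumL L (λ a → F a 0ℚ 0ℚ)))

coordValue : ℚ → Maybe ℕ → ℚ
coordValue x = maybe′ (pow x) 0ℚ

valueAt-move : ∀ x y u v i j →
  valueAt (monomial x y) (move (u , v) (i , j)) ≡ coordValue x (shift u i) * coordValue y (shift v j)
valueAt-move x y u v i j with shift u i | shift v j
... | nothing | w       = sym (*-zeroˡ (coordValue y w))
... | just a  | nothing = sym (*-zeroʳ (pow x a))
... | just a  | just b  = refl

-- x^(u+1), and the term subtracted because a step u = −1 is impossible from coordinate 0 (where 0ⁱ = 1)
lift : ℚ → V → ℚ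
lift x m1 = 1ℚ
lift x z  = x
lift x p1 = x * x

blocked : V → ℚ
blocked m1 = 1ℚ
blocked z  = 0ℚ
blocked p1 = 0ℚ

coordValue-shift : ∀ x u i → x * coordValue x (shift u i) ≡ lift x u * pow x i - blocked u * pow 0ℚ i
coordValue-shift x m1 zero    = solve 1 (λ x → x :* con 0ℚ := con 1ℚ :* con 1ℚ :- con 1ℚ :* con 1ℚ) refl x
coordValue-shift x m1 (suc i) = solve 3 (λ x X Z → x :* X := con 1ℚ :* (x :* X) :- con 1ℚ :* (con 0ℚ :* Z)) refl
                                  x (pow x i) (pow 0ℚ i)
coordValue-shift x z  i       = solve 3 (λ x X Z → x :* X := x :* X :- con 0ℚ :* Z) refl x (pow x i) (pow 0ℚ i)
coordValue-shift x p1 i       = solve 3 (λ x X Z → x :* (x :* X) := x :* x :* X :- con 0ℚ :* Z) refl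
                                  x (pow x i) (pow 0ℚ i)

expand-steps : ∀ S x y X Y X₀ Y₀ →
  sumL allSteps (λ (u , v) → c S u v * ((lift x u * X - blocked u * X₀) * (lift y v * Y - blocked v * Y₀))) ≡
  xyS S x y * (X * Y) - xA₋₁ S x * (X * Y₀) - yB₋₁ S y * (X₀ * Y) + c S m1 m1 * (X₀ * Y₀)
expand-steps S x y X Y X₀ Y₀ = solve 15 (λ x y X Y X₀ Y₀ c₁ c₂ c₃ c₄ c₅ c₆ c₇ c₈ c₉ →
     c₁ :* ((con 1ℚ :* X :- con 1ℚ :* X₀) :* (con 1ℚ :* Y :- con 1ℚ :* Y₀))
     :+ (c₂ :* ((con 1ℚ :* X :- con 1ℚ :* X₀) :* (y :* Y :- con 0ℚ :* Y₀))
     :+ (c₃ :* ((con 1ℚ :* X :- con 1ℚ :* X₀) :* (y :* y :* Y :- con 0ℚ :* Y₀))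
     :+ (c₄ :* ((x :* X :- con 0ℚ :* X₀) :* (con 1ℚ :* Y :- con 1ℚ :* Y₀))
     :+ (c₅ :* ((x :* X :- con 0ℚ :* X₀) :* (y :* Y :- con 0ℚ :* Y₀))
     :+ (c₆ :* ((x :* X :- con 0ℚ :* X₀) :* (y :* y :* Y :- con 0ℚ :* Y₀))
     :+ (c₇ :* ((x :* x :* X :- con 0ℚ :* X₀) :* (con 1ℚ :* Y :- con 1ℚ :* Y₀))
     :+ (c₈ :* ((x :* x :* X :- con 0ℚ :* X₀) :* (y :* Y :- con 0ℚ :* Y₀))
     :+ (c₉ :* ((x :* x :* X :- con 0ℚ :* X₀) :* (y :* y :* Y :- con 0ℚ :* Y₀))
     :+ con 0ℚ))))))))
     := ((c₁ :+ c₂ :* y :+ c₃ :* y :* y) :+ (c₄ :+ c₅ :* y :+ c₆ :* y :* y) :* x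
           :+ (c₇ :+ c₈ :* y :+ c₉ :* y :* y) :* x :* x) :* (X :* Y)
        :- (c₁ :+ c₄ :* x :+ c₇ :* x :* x) :* (X :* Y₀)
        :- (c₁ :+ c₂ :* y :+ c₃ :* y :* y) :* (X₀ :* Y)
        :+ c₁ :* (X₀ :* Y₀))
  refl x y X Y X₀ Y₀ (c S m1 m1) (c S m1 z) (c S m1 p1) (c S z m1) (c S z z) (c S z p1) (c S p1 m1) (c S p1 z) (c S p1 p1)

kernel-at : ∀ S x y i j →
  x * y * sumL (steps S) (λ s → valueAt (monomial x y) (move s (i , j))) ≡
  kernelCombination S x y (λ u v → monomial u v i j)
kernel-at S x y i j = begin
  x * y * sumL (steps S) (valueAt (monomial x y) ∘ next)
    ≡⟨ cong (x * y *_) (sumL-filter (λ s → S (proj₁ s) (proj₂ s)) allSteps (valueAt (monomial x y) ∘ next)) ⟩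
  x * y * sumL allSteps term
    ≡⟨ sumL-*ˡ allSteps (x * y) term ⟨
  sumL allSteps (λ s → x * y * term s)
    ≡⟨ sumL-cong allSteps factorise ⟩
  sumL allSteps (λ (u , v) → c S u v * ((lift x u * X - blocked u * X₀) * (lift y v * Y - blocked v * Y₀)))
    ≡⟨ expand-steps S x y X Y X₀ Y₀ ⟩
  kernelCombination S x y (λ u v → monomial u v i j) ∎
  where
  open ≡-Reasoning
  X Y X₀ Y₀ : ℚ
  X = pow x i
  Y = pow y j
  X₀ = pow 0ℚ i
  Y₀ = pow 0ℚ j
  next : Step → Maybe (ℕ × ℕ)
  next s = move s (i , j)
  term : Step → ℚ
  term s = c S (proj₁ s) (proj₂ s) * valueAt (monomial x y) (next s)
  factorise : ∀ s → x * y * term s ≡ c S (proj₁ s) (proj₂ s) *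
    ((lift x (proj₁ s) * X - blocked (proj₁ s) * X₀) * (lift y (proj₂ s) * Y - blocked (proj₂ s) * Y₀))
  factorise (u , v) = begin
    x * y * (c S u v * valueAt (monomial x y) (move (u , v) (i , j)))
      ≡⟨ cong (λ t → x * y * (c S u v * t)) (valueAt-move x y u v i j) ⟩
    x * y * (c S u v * (coordValue x (shift u i) * coordValue y (shift v j)))
      ≡⟨ solve 5 (λ x y γ X Y → x :* y :* (γ :* (X :* Y)) := γ :* ((x :* X) :* (y :* Y))) refl
           x y (c S u v) (coordValue x (shift u i)) (coordValue y (shift v j)) ⟩
    c S u v * ((x * coordValue x (shift u i)) * (y * coordValue y (shift v j)))
      ≡⟨ cong₂ (λ a b → c S u v * (a * b)) (coordValue-shift x u i) (coordValue-shift y v j) ⟩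
    c S u v * ((lift x u * X - blocked u * X₀) * (lift y v * Y - blocked v * Y₀)) ∎

kernel-at-endpoint : ∀ S x y e →
  x * y * sumL (steps S) (λ s → valueAt (monomial x y) (e >>= move s)) ≡
  kernelCombination S x y (λ u v → valueAt (monomial u v) e)
kernel-at-endpoint S x y nothing =
  trans (trans (cong (x * y *_) (sumL-zero (steps S))) (*-zeroʳ (x * y))) (sym (kernelCombination-zero S x y))
kernel-at-endpoint S x y (just (i , j)) = kernel-at S x y i j

kernel-equation : ∀ S n x y → x * y * Qₙ S (suc n) x y ≡ kernelCombination S x y (Qₙ S n)
kernel-equation S n x y = begin
  x * y * Qₙ S (suc n) x y
    ≡⟨ cong (x * y *_) (trans (Qₙ-by-walks S (suc n) x y) (sumL-words-snoc S n _)) ⟩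
  x * y * sumL W (λ w → sumL (steps S) (λ s → valueAt (monomial x y) (endpoint (0 , 0) (w ++ s ∷ []))))
    ≡⟨ sumL-*ˡ W (x * y) _ ⟨
  sumL W (λ w → x * y * sumL (steps S) (λ s → valueAt (monomial x y) (endpoint (0 , 0) (w ++ s ∷ []))))
    ≡⟨ sumL-cong W (λ w → trans
         (cong (x * y *_) (sumL-cong (steps S) (λ s → cong (valueAt (monomial x y)) (endpoint-snoc (0 , 0) w s))))
         (kernel-at-endpoint S x y (endpoint (0 , 0) w))) ⟩
  sumL W (λ w → kernelCombination S x y (λ u v → valueAt (monomial u v) (endpoint (0 , 0) w)))
    ≡⟨ sumL-kernelCombination S x y W (λ w u v → valueAt (monomial u v) (endpoint (0 , 0) w)) ⟩
  kernelCombination S x y (λ u v → sumL W (valueAt (monomial u v) ∘ endpoint (0 , 0)))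
    ≡⟨ kernelCombination-cong S x y (λ u v → sym (Qₙ-by-walks S n u v)) ⟩
  kernelCombination S x y (Qₙ S n) ∎
  where
  open ≡-Reasoning
  W : List (List Step)
  W = words S n

extend-below : ∀ {m} {P : ℕ → Set} → (∀ k → k < m → P k) → P m → ∀ k → k < suc m → P k
extend-below below at-m k k<m+1 with ℕ.m≤n⇒m<n∨m≡n (ℕ.≤-pred k<m+1)
... | inj₁ k<m  = below k k<m
... | inj₂ refl = at-m

groupSum-Φ : ∀ S m {F p l} → groupSum S (suc m) F p ≡ just l → ∃ λ b → Φ S p ≡ just b
groupSum-Φ S m {F} {p} eq with >>=-just (groupSum S m F p) eq
... | _ , _ , eq₁ with >>=-just (rot S m p) eq₁
... | _ , _ , eq₂ with >>=-just (Φ S p >>= rot S m) eq₂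
... | _ , rot-Φp , _ with >>=-just (Φ S p) rot-Φp
... | b , Φp , _ = b , Φp

groupSum-orbitSum : ∀ S m {F p b l} → Φ S p ≡ just b → groupSum S m F p ≡ just l →
  OrbitDefined S m p × OrbitDefined S m b ×
  l ≡ orbitSum S m p b F
groupSum-orbitSum S zero    Φp refl = (λ _ ()) , (λ _ ()) , refl
groupSum-orbitSum S (suc m) {F} {p} {b} Φp eq
  with >>=-just (groupSum S m F p) eq
... | acc , sum-m , eq₁ with >>=-just (rot S m p) eq₁
... | p₊ , rot-p , eq₂ with >>=-just (Φ S p >>= rot S m) eq₂
... | p₋ , rot-Φp , refl with groupSum-orbitSum S m Φp sum-m
... | C-defined , D-defined , refl =
  extend-below C-defined (fromMaybe-just rot-p) ,
  extend-below D-defined (fromMaybe-just rot-b) ,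
  cong₂ (λ u v → acc + (F u - F v)) (cong (fromMaybe p) (sym rot-p)) (cong (fromMaybe b) (sym rot-b))
  where
  rot-b : rot S m b ≡ just p₋
  rot-b = trans (cong (_>>= rot S m) (sym Φp)) rot-Φp

module _ (S : StepSet) (m₀ : ℕ) (isId : IsId S (suc (suc m₀))) {s : ℚ} (p b : Pt) (Φp : Φ S p ≡ just b)
         (C-defined : OrbitDefined S (suc (suc m₀)) p)
         (D-defined : OrbitDefined S (suc (suc m₀)) b)
         (p-onLevel : OnLevel S s p) where

  open Orbit S m₀ isId {s} p b Φp C-defined D-defined p-onLevel

  private
    M : ℕ
    M = suc (suc m₀)

  orbitSum-xyQ : ∀ n → orbitSum S M p b (xyQ S n) ≡ pow s n * orbitSum S M p b xy
  orbitSum-xyQ zero =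
    trans (sumTo-cong< M (λ k _ → cong₂ _-_ (*-identityʳ (xy (orbitPoint S p k))) (*-identityʳ (xy (orbitPoint S b k)))))
          (sym (*-identityˡ (orbitSum S M p b xy)))
  orbitSum-xyQ (suc n) = begin
    orbitSum S M p b (xyQ S (suc n))        ≡⟨ orbitSum-recurrence (xyQ S (suc n)) (xyQ S n) α β κ vanish recurrence ⟩
    s * orbitSum S M p b (xyQ S n)          ≡⟨ cong (s *_) (orbitSum-xyQ n) ⟩
    s * (pow s n * orbitSum S M p b xy)     ≡⟨ *-assoc s (pow s n) _ ⟨
    pow s (suc n) * orbitSum S M p b xy     ∎
    where
    open ≡-Reasoning
    α β : ℚ → ℚ
    α u = xA₋₁ S u * Qₙ S n u 0ℚ
    β v = yB₋₁ S v * Qₙ S n 0ℚ v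
    κ : ℚ
    κ = c S m1 m1 * Qₙ S n 0ℚ 0ℚ
    vanish : ∀ q → OnLevel S s q → proj₂ q ≡ 0ℚ → α (proj₁ q) ≡ 0ℚ
    vanish q onLevel y≡0 =
      trans (cong (_* Qₙ S n (proj₁ q) 0ℚ) (OnLevel-x-axis {S} {s} {q} onLevel y≡0)) (*-zeroˡ (Qₙ S n (proj₁ q) 0ℚ))
    recurrence : ∀ q → OnLevel S s q → xyQ S (suc n) q ≡ s * xyQ S n q - α (proj₁ q) - β (proj₂ q) + κ
    recurrence (x , y) onLevel = trans (kernel-equation S n x y)
      (cong (λ t → t - α x - β y + κ) (trans (cong (_* Qₙ S n x y) onLevel) (*-assoc s (x * y) (Qₙ S n x y))))

proposition5 : (S : StepSet) → S z z ≡ false → NonSimple S →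
    (m : ℕ) → IsOrderΦΨ S m →
    (x y : ℚ) (x≢0 : x ≢ 0ℚ) (y≢0 : y ≢ 0ℚ) (n : ℕ) (l r : ℚ) →
    groupSum S m (xyQ S n) (x , y) ≡ just l →
    groupSum S m xy (x , y) ≡ just r →
    l ≡ pow (Sxy S x y x≢0 y≢0) n * r
proposition5 S _ _         zero           (() , _)
proposition5 S _ nonSimple (suc zero)     (_ , isId , _) = ⊥-elim (ΦΨ≢id nonSimple isId)
proposition5 S _ nonSimple (suc (suc m₀)) (_ , isId , _) x y x≢0 y≢0 n l r sum-l sum-r = begin
  l                                      ≡⟨ proj₂ (proj₂ orbit-l) ⟩
  orbitSum S M (x , y) b (xyQ S n)       ≡⟨ orbitSum-xyQ S m₀ isId (x , y) b Φp (proj₁ orbit-l) (proj₁ (proj₂ orbit-l))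
                                              (sym (Sxy-times-xy S x y x≢0 y≢0)) n ⟩
  pow s n * orbitSum S M (x , y) b xy    ≡⟨ cong (pow s n *_) (proj₂ (proj₂ orbit-r)) ⟨
  pow s n * r                            ∎
  where
  open ≡-Reasoning
  M : ℕ
  M = suc (suc m₀)
  s : ℚ
  s = Sxy S x y x≢0 y≢0
  Φ-defined : ∃ λ b → Φ S (x , y) ≡ just b
  Φ-defined = groupSum-Φ S (suc m₀) sum-l
  b : Pt
  b = proj₁ Φ-defined
  Φp : Φ S (x , y) ≡ just b
  Φp = proj₂ Φ-defined
  orbit-l : OrbitDefined S M (x , y) × OrbitDefined S M b × l ≡ orbitSum S M (x , y) b (xyQ S n)
  orbit-l = groupSum-orbitSum S M Φp sum-l
  orbit-r : OrbitDefined S M (x , y) × OrbitDefined S M b × r ≡ orbitSum S M (x , y) b xy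
  orbit-r = groupSum-orbitSum S M Φp sum-r
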